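{- Let $d,n$ be positive integers and $\alpha\ge 1/2$. Every $\alpha$-separator of the grid graph $G_d(n)$ has cardinality at least $(1-\alpha)n^{d-1}/d$.
   Context: $G_d(n)$ is the graph with vertex set $\{0,1,\dots,n-1\}^d$, two vertices adjacent iff their coordinate vectors differ in exactly one coordinate and there by exactly $1$. For a graph $H=(W,F)$, a separator is a set $C\subset W$ such that $H[W\setminus C]$ is not connected; it is an $\alpha$-separator if every connected component of $H[W\setminus C]$ has at most $\alpha|W|$ vertices.
   Formalization: The parameter α ranges over the rationals. -}

module Defs where

open import Data.Nat using (ℕ; ∣_-_∣)
open import Data.Fin using (Fin; toℕ)
open import Data.Vec using (Vec; lookup)
open import Data.List using (List; length)
open import Data.List.Membership.Propositional using (_∈_)
open import Data.List.Relation.Unary.All using (All)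
open import Data.List.Relation.Unary.Unique.Propositional using (Unique)
open import Data.Product using (Σ; ∃; _×_)
open import Data.Integer using (+_)
open import Data.Rational using (ℚ; _/_; _≤_; _*_)
open import Relation.Binary.PropositionalEquality using (_≡_; _≢_)
open import Relation.Nullary using (¬_)

Vertex : ℕ → ℕ → Set
Vertex d n = Vec (Fin n) d

Adj : ∀ {d n} → Vertex d n → Vertex d n → Set
Adj {d} x y = Σ (Fin d) λ i →
  (∣ toℕ (lookup x i) - toℕ (lookup y i) ∣ ≡ 1) ×
  (∀ j → j ≢ i → lookup x j ≡ lookup y j)

data Reach {d n : ℕ} (C : List (Vertex d n)) (x : Vertex d n) : Vertex d n → Set where
  here : ¬ (x ∈ C) → Reach C x x
  step : ∀ {y z} → Reach C x y → Adj y z → ¬ (z ∈ C) → Reach C x z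

IsSeparator : ∀ {d n} → List (Vertex d n) → Set
IsSeparator {d} {n} C =
  Σ (Vertex d n) λ x → Σ (Vertex d n) λ y →
    ¬ (x ∈ C) × ¬ (y ∈ C) × ¬ (Reach C x y)

ℕtoℚ : ℕ → ℚ
ℕtoℚ k = + k / 1

-- The component of a
-- vertex v ∉ C is the set of vertices reachable from v; "has at most m
-- vertices" is expressed as: every duplicate-free list of its members has
-- length at most m.
IsAlphaSeparator : ∀ {d n} → ℚ → List (Vertex d n) → Set
IsAlphaSeparator {d} {n} α C =
  IsSeparator C ×
  (∀ (v : Vertex d n) → ¬ (v ∈ C) →
     ∀ (S : List (Vertex d n)) → Unique S → All (Reach C v) S →
       ℕtoℚ (length S) ≤ α * ℕtoℚ (n Data.Nat.^ d))

module Submission where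

-- The core is a counting statement, large-component: G_d(n) − C contains a
-- set G of distinct vertices, all reachable from one root, with
-- n^d ≤ |G| + d·n·|C|.  It is proved by induction on d.  Averaging over the n
-- layers {x : x₀ = a} gives a layer a meeting C in at most |C|/n vertices;
-- induction inside that layer gives a large reachable set Gs there; and by
-- the cylinder lemma every g ∈ Gs whose whole line {(c, g) : c < n} misses C
-- contributes that line to the component of the lifted root.  At most |C|
-- lines are blocked, which costs n·|C| and closes the induction.
-- For the theorem, G lies in one component, so |G| ≤ α·n^d by the
-- α-separator condition, and n^d ≤ α·n^d + d·n·|C| rearranges in ℚ to the
-- claim.

open import Defs
open import Data.Nat using (ℕ; _∸_; _^_; NonZero)
open import Data.List using (List; length)
open import Data.List.Relation.Unary.Unique.Propositional using (Unique)
open import Data.Rational using (ℚ; ½; 1ℚ; _≤_; _*_; _-_)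

open import Data.Nat as ℕ using (zero; suc; z≤n; s≤s; ∣_-_∣)
import Data.Nat.Properties as ℕP
open import Data.Nat.Divisibility using (∣1⇒≡1)
open import Data.Nat.Coprimality using (Coprime)
open import Data.Integer as ℤ using (+_)
import Data.Integer.Properties as ℤP
import Data.Rational as Q
open import Data.Rational using (mkℚ; Positive; NonNegative)
import Data.Rational.Properties as QP
import Data.Rational.Solver as QSolver
open import Data.Product using (Σ; _×_; _,_; proj₂)
open import Data.Empty using (⊥-elim)
open import Data.Bool using (true; false; if_then_else_)
open import Data.Fin as F using (Fin; toℕ; fromℕ<)
import Data.Fin.Properties as FP
open import Data.Vec using (_∷_; []; lookup; head; tail)
import Data.Vec.Properties as VP
open import Data.Vec.Functional using (Vector)
open import Data.List using ([]; _∷_; filter; map; cartesianProductWith; allFin)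
import Data.List.Properties as LP
open import Data.List.Membership.Propositional using (_∈_; _∉_)
open import Data.List.Membership.Propositional.Properties
  using (∈-cartesianProductWith⁻; ∈-filter⁺; ∈-filter⁻; ∈-map⁺)
open import Data.List.Membership.DecPropositional as DecMembership using ()
open import Data.List.Relation.Unary.Any using (here; there; _─_; index)
open import Data.List.Relation.Unary.All as All using (All; []; _∷_)
open import Data.List.Relation.Unary.AllPairs using ([]; _∷_)
import Data.List.Relation.Unary.Unique.Propositional.Properties as UniqueP
open import Algebra.Properties.CommutativeMonoid.Sum ℕP.+-0-commutativeMonoid
  using (sum; sum-cong-≗; ∑-distrib-+; sum-replicate-zero)
open import Algebra.Properties.CommutativeSemigroup ℕP.*-commutativeSemigroup
  using (x∙yz≈y∙xz)
open import Relation.Binary.PropositionalEquality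
open import Relation.Unary.Properties using (∁?)
open import Relation.Nullary using (Dec; yes; no; does)
open import Relation.Binary.Definitions using (DecidableEquality)

coprime-1 : ∀ a → Coprime a 1
coprime-1 a (_ , d∣1) = ∣1⇒≡1 d∣1

ℕtoℚ-mkℚ : ∀ a → ℕtoℚ a ≡ mkℚ (+ a) 0 (coprime-1 a)
ℕtoℚ-mkℚ a = QP.normalize-coprime (coprime-1 a)

ℕtoℚ-+ : ∀ a b → ℕtoℚ (a ℕ.+ b) ≡ ℕtoℚ a Q.+ ℕtoℚ b
ℕtoℚ-+ a b = trans (cong (Q._/ 1) numerator)
                   (sym (cong₂ Q._+_ (ℕtoℚ-mkℚ a) (ℕtoℚ-mkℚ b)))
  where
  numerator : + (a ℕ.+ b) ≡ + a ℤ.* + 1 ℤ.+ + b ℤ.* + 1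
  numerator = trans (ℤP.pos-+ a b)
    (sym (cong₂ ℤ._+_ (ℤP.*-identityʳ (+ a)) (ℤP.*-identityʳ (+ b))))

ℕtoℚ-* : ∀ a b → ℕtoℚ (a ℕ.* b) ≡ ℕtoℚ a * ℕtoℚ b
ℕtoℚ-* a b = trans (cong (Q._/ 1) (ℤP.pos-* a b))
                   (sym (cong₂ _*_ (ℕtoℚ-mkℚ a) (ℕtoℚ-mkℚ b)))

ℕtoℚ-mono : ∀ {a b} → a ℕ.≤ b → ℕtoℚ a ≤ ℕtoℚ b
ℕtoℚ-mono {a} {b} a≤b rewrite ℕtoℚ-mkℚ a | ℕtoℚ-mkℚ b =
  Q.*≤* (subst₂ ℤ._≤_ (sym (ℤP.*-identityʳ (+ a))) (sym (ℤP.*-identityʳ (+ b)))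
                (ℤ.+≤+ a≤b))

ℕtoℚ-pos : ∀ m → Positive (ℕtoℚ (suc m))
ℕtoℚ-pos m = subst Positive (sym (ℕtoℚ-mkℚ (suc m))) _

rearrange-bound : (α m M g K : ℚ) → .{{Positive m}} →
  m * M ≤ g Q.+ m * K → g ≤ α * (m * M) → (1ℚ - α) * M ≤ K
rearrange-bound α m M g K total part = QP.*-cancelˡ-≤-pos m (begin
  m * ((1ℚ - α) * M)                             ≡⟨ expand ⟩
  m * M Q.+ Q.- (α * (m * M))                    ≤⟨ QP.+-monoˡ-≤ _ (QP.≤-trans total (QP.+-monoˡ-≤ (m * K) part)) ⟩
  (α * (m * M) Q.+ m * K) Q.+ Q.- (α * (m * M))  ≡⟨ cancel ⟩
  m * K                                          ∎)
  where
  open QP.≤-Reasoning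
  open QSolver.+-*-Solver
  expand : m * ((1ℚ - α) * M) ≡ m * M Q.+ Q.- (α * (m * M))
  expand = solve 3 (λ a x y → x :* ((con 1ℚ :- a) :* y) := x :* y :- (a :* (x :* y))) refl α m M
  cancel : (α * (m * M) Q.+ m * K) Q.+ Q.- (α * (m * M)) ≡ m * K
  cancel = solve 4 (λ a x y k → (a :* (x :* y) :+ x :* k) :- (a :* (x :* y)) := x :* k) refl α m M K

module _ {d n : ℕ} {C : List (Vertex d n)} where

  reach-start : ∀ {x y} → Reach C x y → x ∉ C
  reach-start (here x∉C) = x∉C
  reach-start (step r _ _) = reach-start r

  adj-sym : ∀ {x y : Vertex d n} → Adj x y → Adj y x
  adj-sym {x} {y} (i , dist , same) =
    i , trans (ℕP.∣-∣-comm (toℕ (lookup y i)) (toℕ (lookup x i))) dist ,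
    λ j j≢i → sym (same j j≢i)

  reach-cons : ∀ {w x y} → Adj w x → w ∉ C → Reach C x y → Reach C w y
  reach-cons a w∉C (here x∉C) = step (here w∉C) a x∉C
  reach-cons a w∉C (step r b z∉C) = step (reach-cons a w∉C r) b z∉C

  reach-sym : ∀ {x y} → Reach C x y → Reach C y x
  reach-sym (here x∉C) = here x∉C
  reach-sym (step {y} {z} r a z∉C) = reach-cons (adj-sym {y} {z} a) z∉C (reach-sym r)

  reach-trans : ∀ {x y z} → Reach C x y → Reach C y z → Reach C x z
  reach-trans r (here _) = r
  reach-trans r (step s a z∉C) = step (reach-trans r s) a z∉C

adj-cons : ∀ {d n} (a : Fin n) {y z : Vertex d n} → Adj y z → Adj (a ∷ y) (a ∷ z)
adj-cons a {y} {z} (i , dist , same) = F.suc i , dist , same′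
  where
  same′ : ∀ j → j ≢ F.suc i → lookup (a ∷ y) j ≡ lookup (a ∷ z) j
  same′ F.zero _ = refl
  same′ (F.suc j) j≢i = same j (λ eq → j≢i (cong F.suc eq))

reach-layer : ∀ {d n} (a : Fin n) (C : List (Vertex (suc d) n)) (S : List (Vertex d n)) →
  (∀ {z} → (a ∷ z) ∈ C → z ∈ S) →
  ∀ {y z} → Reach S y z → Reach C (a ∷ y) (a ∷ z)
reach-layer a C S covers (here y∉S) = here (λ m → y∉S (covers m))
reach-layer a C S covers (step r adj z∉S) =
  step (reach-layer a C S covers r) (adj-cons a adj) (λ m → z∉S (covers m))

∣k-suc-k∣≡1 : ∀ k → ∣ k - suc k ∣ ≡ 1
∣k-suc-k∣≡1 zero = refl
∣k-suc-k∣≡1 (suc k) = ∣k-suc-k∣≡1 k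

module _ {d n' : ℕ} (C : List (Vertex (suc d) (suc n'))) (g : Vertex d (suc n'))
         (line-free : ∀ c → (c ∷ g) ∉ C) where

  private
    line-step : ∀ k (p : k ℕ.< suc n') (q : suc k ℕ.< suc n') →
      Adj (fromℕ< p ∷ g) (fromℕ< q ∷ g)
    line-step k p q = F.zero , dist , same
      where
      dist : ∣ toℕ (fromℕ< p) - toℕ (fromℕ< q) ∣ ≡ 1
      dist rewrite FP.toℕ-fromℕ< p | FP.toℕ-fromℕ< q = ∣k-suc-k∣≡1 k
      same : ∀ j → j ≢ F.zero → lookup (fromℕ< p ∷ g) j ≡ lookup (fromℕ< q ∷ g) j
      same F.zero j≢0 = ⊥-elim (j≢0 refl)
      same (F.suc j) _ = refl

    from-origin : ∀ k (p : k ℕ.< suc n') → Reach C (F.zero ∷ g) (fromℕ< p ∷ g)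
    from-origin zero p = here (line-free F.zero)
    from-origin (suc k) q =
      step (from-origin k p) (line-step k p q) (line-free _)
      where p = ℕP.<-trans (ℕP.n<1+n k) q

    origin-to : ∀ b → Reach C (F.zero ∷ g) (b ∷ g)
    origin-to b = subst (λ c → Reach C (F.zero ∷ g) (c ∷ g))
      (FP.fromℕ<-toℕ b (FP.toℕ<n b)) (from-origin (toℕ b) (FP.toℕ<n b))

  line-connected : ∀ a b → Reach C (a ∷ g) (b ∷ g)
  line-connected a b = reach-trans (reach-sym (origin-to a)) (origin-to b)

∈-─ : ∀ {A : Set} {x z : A} {ys} (x∈ys : x ∈ ys) → z ∈ ys → x ≢ z → z ∈ (ys ─ x∈ys)
∈-─ (here refl) (here refl) x≢z = ⊥-elim (x≢z refl)
∈-─ (here _) (there z∈ys) _ = z∈ys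
∈-─ (there _) (here eq) _ = here eq
∈-─ (there x∈ys) (there z∈ys) x≢z = there (∈-─ x∈ys z∈ys x≢z)

unique-⊆-length : ∀ {A : Set} {xs ys : List A} →
  Unique xs → All (_∈ ys) xs → length xs ℕ.≤ length ys
unique-⊆-length {xs = []} _ _ = z≤n
unique-⊆-length {xs = x ∷ xs} {ys} (x∉xs ∷ u) (x∈ys ∷ xs⊆ys) =
  subst (suc (length xs) ℕ.≤_) (sym (LP.length-removeAt′ ys (index x∈ys)))
    (s≤s (unique-⊆-length u (All.zipWith (λ (x≢z , z∈ys) → ∈-─ x∈ys z∈ys x≢z)
                                         (x∉xs , xs⊆ys))))

module _ {A : Set} {P : A → Set} (P? : ∀ x → Dec (P x)) where

  length-filter-split : ∀ xs →
    length xs ≡ length (filter (∁? P?) xs) ℕ.+ length (filter P? xs)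
  length-filter-split [] = refl
  length-filter-split (x ∷ xs) with does (P? x)
  ... | true  = trans (cong suc (length-filter-split xs)) (sym (ℕP.+-suc _ _))
  ... | false = cong suc (length-filter-split xs)

module _ {A : Set} (_≟_ : DecidableEquality A) (P : List A) where

  private
    inP? : ∀ x → Dec (x ∈ P)
    inP? x = DecMembership._∈?_ _≟_ x P

  outside : List A → List A
  outside = filter (∁? inP?)

  length-outside : ∀ xs → Unique xs → length xs ℕ.≤ length (outside xs) ℕ.+ length P
  length-outside xs u = begin
    length xs                                           ≡⟨ length-filter-split inP? xs ⟩
    length (outside xs) ℕ.+ length (filter inP? xs)     ≤⟨ ℕP.+-monoʳ-≤ _ inside-bound ⟩
    length (outside xs) ℕ.+ length P                    ∎
    where
    open ℕP.≤-Reasoning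
    inside-bound : length (filter inP? xs) ℕ.≤ length P
    inside-bound = unique-⊆-length (UniqueP.filter⁺ inP? u)
      (All.tabulate (λ m → proj₂ (∈-filter⁻ inP? {xs = xs} m)))

  outside-unique : ∀ {xs} → Unique xs → Unique (outside xs)
  outside-unique = UniqueP.filter⁺ (∁? inP?)

  outside-∈ : ∀ {x} xs → x ∈ outside xs → x ∈ xs × x ∉ P
  outside-∈ xs = ∈-filter⁻ (∁? inP?) {xs = xs}

length-cartesianProductWith : ∀ {A B D : Set} (f : A → B → D) xs ys →
  length (cartesianProductWith f xs ys) ≡ length xs ℕ.* length ys
length-cartesianProductWith f [] ys = refl
length-cartesianProductWith f (x ∷ xs) ys =
  trans (LP.length-++ (map (f x) ys))
        (cong₂ ℕ._+_ (LP.length-map (f x) ys) (length-cartesianProductWith f xs ys))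

record ComponentPart {d n : ℕ} (C : List (Vertex d n)) : Set where
  constructor component-part
  field
    root      : Vertex d n
    members   : List (Vertex d n)
    distinct  : Unique members
    reachable : All (Reach C root) members

size : ∀ {d n} {C : List (Vertex d n)} → ComponentPart C → ℕ
size G = length (ComponentPart.members G)

cylinder : ∀ {d n'} (C : List (Vertex (suc d) (suc n'))) (a : Fin (suc n'))
  (S : List (Vertex d (suc n'))) → (∀ {z} → (a ∷ z) ∈ C → z ∈ S) →
  (Gs : ComponentPart S) →
  Σ (ComponentPart C) λ G → suc n' ℕ.* size Gs ℕ.≤ size G ℕ.+ suc n' ℕ.* length C
cylinder {d} {n'} C a S covers (component-part r' Gs distinct reachable) =
  component-part (a ∷ r') G G-distinct (All.tabulate G-reachable) , bound
  where
  n = suc n'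
  _≟_ = VP.≡-dec {n = d} (F._≟_ {suc n'})
  -- projections of C forgetting the first coordinate: the blocked lines
  P = map tail C
  free = outside _≟_ P Gs
  G = cartesianProductWith _∷_ (allFin n) free

  G-distinct : Unique G
  G-distinct = UniqueP.cartesianProductWith⁺ _∷_ VP.∷-injective
    (UniqueP.allFin⁺ n) (outside-unique _≟_ P distinct)

  G-reachable : ∀ {v} → v ∈ G → Reach C (a ∷ r') v
  G-reachable v∈G with ∈-cartesianProductWith⁻ _∷_ (allFin n) free v∈G
  ... | b , g , _ , g∈free , refl with outside-∈ _≟_ P Gs g∈free
  ... | g∈Gs , g∉P = reach-trans (reach-layer a C S covers (All.lookup reachable g∈Gs))
                                 (line-connected C g line-free a b)
    where
    line-free : ∀ c → (c ∷ g) ∉ C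
    line-free c m = g∉P (∈-map⁺ tail m)

  size-G : length G ≡ n ℕ.* length free
  size-G = trans (length-cartesianProductWith _∷_ (allFin n) free)
                 (cong (ℕ._* length free) (LP.length-tabulate {n = n} (λ x → x)))

  bound : n ℕ.* length Gs ℕ.≤ length G ℕ.+ n ℕ.* length C
  bound = begin
    n ℕ.* length Gs                          ≤⟨ ℕP.*-monoʳ-≤ n (length-outside _≟_ P Gs distinct) ⟩
    n ℕ.* (length free ℕ.+ length P)         ≡⟨ ℕP.*-distribˡ-+ n (length free) (length P) ⟩
    n ℕ.* length free ℕ.+ n ℕ.* length P     ≡⟨ cong₂ ℕ._+_ (sym size-G) (cong (n ℕ.*_) (LP.length-map tail C)) ⟩
    length G ℕ.+ n ℕ.* length C              ∎
    where open ℕP.≤-Reasoning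

layer : ∀ {d n} → Fin n → List (Vertex (suc d) n) → List (Vertex d n)
layer a C = map tail (filter (λ v → head v F.≟ a) C)

layer-covers : ∀ {d n} (a : Fin n) (C : List (Vertex (suc d) n)) {z : Vertex d n} →
  (a ∷ z) ∈ C → z ∈ layer a C
layer-covers a C m = ∈-map⁺ tail (∈-filter⁺ (λ v → head v F.≟ a) m refl)

δ : ∀ {n} → Fin n → Fin n → ℕ
δ x a = if does (x F.≟ a) then 1 else 0

∑δ≡1 : ∀ {n} (x : Fin n) → sum (δ x) ≡ 1
∑δ≡1 {suc n} F.zero = cong suc (sum-replicate-zero n)
∑δ≡1 (F.suc x) = ∑δ≡1 x

layer-cons : ∀ {d n} (a : Fin n) (v : Vertex (suc d) n) C →
  length (layer a (v ∷ C)) ≡ δ (head v) a ℕ.+ length (layer a C)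
layer-cons a v C with head v F.≟ a
... | yes _ = refl
... | no _ = refl

∑-layers : ∀ {d n} (C : List (Vertex (suc d) n)) → sum (λ a → length (layer a C)) ≡ length C
∑-layers {n = n} [] = sum-replicate-zero n
∑-layers (v ∷ C) = begin
  sum (λ a → length (layer a (v ∷ C)))                      ≡⟨ sum-cong-≗ (λ a → layer-cons a v C) ⟩
  sum (λ a → δ (head v) a ℕ.+ length (layer a C))           ≡⟨ ∑-distrib-+ (δ (head v)) (λ a → length (layer a C)) ⟩
  sum (δ (head v)) ℕ.+ sum (λ a → length (layer a C))       ≡⟨ cong₂ ℕ._+_ (∑δ≡1 (head v)) (∑-layers C) ⟩
  suc (length C)                                            ∎
  where open ≡-Reasoning

below-average : ∀ {n} (f : Vector ℕ (suc n)) → Σ (Fin (suc n)) λ a → suc n ℕ.* f a ℕ.≤ sum f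
below-average {zero} f = F.zero , ℕP.≤-refl
below-average {suc n} f with below-average (λ a → f (F.suc a))
... | b , fb-small with f F.zero ℕP.≤? f (F.suc b)
... | yes f0≤fb = F.zero ,
      ℕP.+-monoʳ-≤ (f F.zero) (ℕP.≤-trans (ℕP.*-monoʳ-≤ (suc n) f0≤fb) fb-small)
... | no f0≰fb = F.suc b , ℕP.+-mono-≤ (ℕP.<⇒≤ (ℕP.≰⇒> f0≰fb)) fb-small

thin-layer : ∀ {d n'} (C : List (Vertex (suc d) (suc n'))) →
  Σ (Fin (suc n')) λ a → suc n' ℕ.* length (layer a C) ℕ.≤ length C
thin-layer {n' = n'} C with below-average (λ a → length (layer a C))
... | a , small = a , subst (suc n' ℕ.* length (layer a C) ℕ.≤_) (∑-layers C) small

large-component : ∀ d n' (C : List (Vertex (suc d) (suc n'))) →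
  Σ (ComponentPart C) λ G → suc n' ^ suc d ℕ.≤ size G ℕ.+ suc d ℕ.* (suc n' ℕ.* length C)
-- On a line missing C, the whole line is one component (the cylinder over a point).
large-component zero n' [] with cylinder [] F.zero [] (λ ())
                                   (component-part [] ([] ∷ []) ([] ∷ []) (here (λ ()) ∷ []))
... | G , bound = G , subst (λ t → suc n' ℕ.* 1 ℕ.≤ size G ℕ.+ t)
                            (sym (ℕP.+-identityʳ (suc n' ℕ.* 0))) bound
-- A line meeting C: the bound n ≤ n·|C| needs no component at all.
large-component zero n' C@(_ ∷ _) =
  component-part (F.zero ∷ []) [] [] [] ,
  ℕP.≤-trans (ℕP.*-monoʳ-≤ (suc n') (s≤s z≤n)) (ℕP.m≤m+n _ 0)
large-component (suc d) n' C with thin-layer C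
... | a , thin with large-component d n' (layer a C)
... | Gs , Gs-large with cylinder C a (layer a C) (layer-covers a C) Gs
... | G , G-large = G , bound
  where
  n = suc n'
  D = suc d
  k = length C
  kₐ = length (layer a C)
  bound : n ℕ.* n ^ D ℕ.≤ size G ℕ.+ suc D ℕ.* (n ℕ.* k)
  bound = begin
    n ℕ.* n ^ D                                      ≤⟨ ℕP.*-monoʳ-≤ n Gs-large ⟩
    n ℕ.* (size Gs ℕ.+ D ℕ.* (n ℕ.* kₐ))             ≡⟨ ℕP.*-distribˡ-+ n (size Gs) _ ⟩
    n ℕ.* size Gs ℕ.+ n ℕ.* (D ℕ.* (n ℕ.* kₐ))       ≡⟨ cong (n ℕ.* size Gs ℕ.+_) (x∙yz≈y∙xz n D (n ℕ.* kₐ)) ⟩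
    n ℕ.* size Gs ℕ.+ D ℕ.* (n ℕ.* (n ℕ.* kₐ))       ≤⟨ ℕP.+-mono-≤ G-large (ℕP.*-monoʳ-≤ D (ℕP.*-monoʳ-≤ n thin)) ⟩
    (size G ℕ.+ n ℕ.* k) ℕ.+ D ℕ.* (n ℕ.* k)         ≡⟨ ℕP.+-assoc (size G) _ _ ⟩
    size G ℕ.+ suc D ℕ.* (n ℕ.* k)                   ∎
    where open ℕP.≤-Reasoning

large-component-ℚ : ∀ n N g D k → n ℕ.* N ℕ.≤ g ℕ.+ D ℕ.* (n ℕ.* k) →
  ℕtoℚ n * ℕtoℚ N ≤ ℕtoℚ g Q.+ ℕtoℚ n * (ℕtoℚ D * ℕtoℚ k)
large-component-ℚ n N g D k bound = subst₂ _≤_ (ℕtoℚ-* n N) rhs (ℕtoℚ-mono regrouped)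
  where
  regrouped : n ℕ.* N ℕ.≤ g ℕ.+ n ℕ.* (D ℕ.* k)
  regrouped = subst (λ t → n ℕ.* N ℕ.≤ g ℕ.+ t) (x∙yz≈y∙xz D n k) bound
  rhs : ℕtoℚ (g ℕ.+ n ℕ.* (D ℕ.* k)) ≡ ℕtoℚ g Q.+ ℕtoℚ n * (ℕtoℚ D * ℕtoℚ k)
  rhs = begin
    ℕtoℚ (g ℕ.+ n ℕ.* (D ℕ.* k))                 ≡⟨ ℕtoℚ-+ g _ ⟩
    ℕtoℚ g Q.+ ℕtoℚ (n ℕ.* (D ℕ.* k))            ≡⟨ cong (ℕtoℚ g Q.+_) (ℕtoℚ-* n _) ⟩
    ℕtoℚ g Q.+ ℕtoℚ n * ℕtoℚ (D ℕ.* k)           ≡⟨ cong (λ t → ℕtoℚ g Q.+ ℕtoℚ n * t) (ℕtoℚ-* D k) ⟩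
    ℕtoℚ g Q.+ ℕtoℚ n * (ℕtoℚ D * ℕtoℚ k)        ∎
    where open ≡-Reasoning

component-part-bound : ∀ {d n} {C : List (Vertex d n)} (α : ℚ) → .{{NonNegative α}} →
  (∀ v → v ∉ C → ∀ S → Unique S → All (Reach C v) S → ℕtoℚ (length S) ≤ α * ℕtoℚ (n ^ d)) →
  (G : ComponentPart C) → ℕtoℚ (size G) ≤ α * ℕtoℚ (n ^ d)
component-part-bound {d} {n} α _ (component-part _ [] _ _) =
  QP.≤-trans (QP.≤-reflexive (sym (QP.*-zeroʳ α)))
             (QP.*-monoˡ-≤-nonNeg α (ℕtoℚ-mono {0} {n ^ d} z≤n))
component-part-bound α bounded (component-part r (v ∷ G) distinct reachable) =
  bounded r (reach-start (All.head reachable)) (v ∷ G) distinct reachable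

theorem4 : (d n : ℕ) → .{{NonZero d}} → .{{NonZero n}} →
    (α : ℚ) → ½ ≤ α →
    (C : List (Vertex d n)) → Unique C → IsAlphaSeparator α C →
    (1ℚ - α) * ℕtoℚ (n ^ (d ∸ 1)) ≤ ℕtoℚ d * ℕtoℚ (length C)
theorem4 (suc d') (suc n') α ½≤α C _ (_ , bounded) with large-component d' n' C
... | G , G-large =
  rearrange-bound α (ℕtoℚ n) (ℕtoℚ (n ^ d')) (ℕtoℚ (size G)) (ℕtoℚ (suc d') * ℕtoℚ (length C))
    {{ℕtoℚ-pos n'}}
    (large-component-ℚ n (n ^ d') (size G) (suc d') (length C) G-large)
    (subst (λ t → ℕtoℚ (size G) ≤ α * t) (ℕtoℚ-* n (n ^ d'))
           (component-part-bound α {{α≥0}} bounded G))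
  where
  n = suc n'
  α≥0 : NonNegative α
  α≥0 = Q.nonNegative (QP.≤-trans (Q.*≤* (ℤ.+≤+ z≤n)) ½≤α)
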